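{- Let $G$ be a finite group, $H$ a proper subgroup of $G$, $C$ an inverse-closed subset of $G\setminus\{1\}$, and $\Gamma=\mathrm{Cay}(G,H,C)$. Let $x\in G\setminus H$. Then $\deg_\Gamma(x)=|C|$ if and only if $x\in\bigcap_{c\in C}Hc$.
   Context: $C$ inverse-closed means $C^{ -1}\subseteq C$. The relative Cayley graph $\Gamma=\mathrm{Cay}(G,H,C)$ is the simple graph with vertex set $G$ in which two distinct vertices $x,y$ are adjacent if and only if at least one of $x,y$ lies in $H$ and $x^{ -1}y\in C$. -}

module Defs where

open import Data.Nat using (ℕ)
open import Data.Fin using (Fin)
open import Data.Fin.Properties using (_≟_)
open import Data.Fin.Subset using (Subset; _∈_; _∉_; ∣_∣)
open import Data.Fin.Subset.Properties using (_∈?_)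
open import Data.Vec using (tabulate)
open import Data.Product using (Σ; _×_; _,_; ∃; ∃-syntax)
open import Data.Sum using (_⊎_)
open import Relation.Binary.PropositionalEquality using (_≡_; _≢_)
open import Relation.Nullary using (Dec; does; ¬_)
open import Relation.Nullary.Decidable using (_×-dec_; _⊎-dec_; ¬?)
open import Algebra.Structures using (IsGroup)

-- A finite group of order n, presented on the carrier Fin n
-- (every finite group is isomorphic to one of this form).
record FiniteGroup (n : ℕ) : Set where
  field
    _·_     : Fin n → Fin n → Fin n
    e       : Fin n
    inv     : Fin n → Fin n
    isGroup : IsGroup {A = Fin n} _≡_ _·_ e inv
  infixl 7 _·_

module _ {n : ℕ} (G : FiniteGroup n) where
  open FiniteGroup G

  IsSubgroup : Subset n → Set
  IsSubgroup H = (e ∈ H)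
               × (∀ {a b} → a ∈ H → b ∈ H → (a · b) ∈ H)
               × (∀ {a} → a ∈ H → inv a ∈ H)

  IsProper : Subset n → Set
  IsProper H = ∃[ g ] g ∉ H

  InverseClosed : Subset n → Set
  InverseClosed C = ∀ {c} → c ∈ C → inv c ∈ C

  Adjacent : (H C : Subset n) → Fin n → Fin n → Set
  Adjacent H C x y = (x ≢ y) × ((x ∈ H ⊎ y ∈ H) × ((inv x · y) ∈ C))

  adjacent? : (H C : Subset n) → ∀ x y → Dec (Adjacent H C x y)
  adjacent? H C x y = ¬? (x ≟ y) ×-dec (((x ∈? H) ⊎-dec (y ∈? H)) ×-dec ((inv x · y) ∈? C))

  neighbourhood : (H C : Subset n) → Fin n → Subset n
  neighbourhood H C x = tabulate (λ y → does (adjacent? H C x y))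

  degree : (H C : Subset n) → Fin n → ℕ
  degree H C x = ∣ neighbourhood H C x ∣

  InRightCoset : Subset n → Fin n → Fin n → Set
  InRightCoset H c x = ∃[ h ] (h ∈ H × x ≡ h · c)

  InCosetIntersection : (H C : Subset n) → Fin n → Set
  InCosetIntersection H C x = ∀ c → c ∈ C → InRightCoset H c x

module Submission where

-- For x ∉ H every neighbour y of x lies in H, so y ↦ x⁻¹y injects the
-- neighbourhood of x into C, with image {c ∈ C | xc ∈ H}. Hence deg x ≤ |C|,
-- with equality exactly when xC ⊆ H; as C is inverse-closed this says
-- xc⁻¹ ∈ H, i.e. x ∈ Hc, for every c ∈ C.

open import Defs
open import Algebra.Bundles using (Group)
import Algebra.Properties.Group as GroupProperties
open import Data.Nat using (ℕ; suc; _≤_; _<_; z≤n; s≤s)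
open import Data.Nat.Properties using (≤-antisym; <-irrefl; module ≤-Reasoning)
open import Data.Fin using (Fin; zero; suc)
open import Data.Fin.Subset using (Subset; _∈_; _∉_; ∣_∣; _-_; inside; outside; ⊥; _⊂_)
open import Data.Fin.Subset.Properties
  using ( _∈?_; nonempty?; Empty-unique; ∣⊥∣≡0; p─⊥≡p; p─q⊆p
        ; x∈p∧x≢y⇒x∈p-y; x∈p⇒p-x⊂p; x∈p⇒∣p-x∣<∣p∣)
open import Data.Fin.Subset.Induction using (⊂-wellFounded; Acc; acc)
open import Data.Vec using (_∷_; tabulate; here; there)
open import Data.Vec.Properties using (lookup∘tabulate; []=⇒lookup; lookup⇒[]=)
open import Data.Product using (_×_; _,_; proj₂)
open import Data.Sum using (inj₁; inj₂)
open import Function using (_∘_; _⇔_; mk⇔; Equivalence)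
open import Function.Definitions using (Injective)
import Function.Properties.Equivalence as ⇔
open import Level using (Level; 0ℓ)
open import Relation.Nullary using (yes; no; does; contradiction)
open import Relation.Nullary.Decidable using (dec-true; decidable-stable)
open import Relation.Unary using (Pred; Decidable)
open import Relation.Binary.PropositionalEquality using (_≡_; sym; trans; cong; subst)

private
  variable
    ℓ : Level
    m n : ℕ
    p q : Subset n

∈-tabulate⁻ : {P : Pred (Fin n) ℓ} (P? : Decidable P) {y : Fin n} →
              y ∈ tabulate (does ∘ P?) → P y
∈-tabulate⁻ P? {y} y∈ with P? y | trans (sym (lookup∘tabulate _ y)) ([]=⇒lookup y∈)
... | yes py | _  = py
... | no  _  | ()

∈-tabulate⁺ : {P : Pred (Fin n) ℓ} (P? : Decidable P) {y : Fin n} →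
              P y → y ∈ tabulate (does ∘ P?)
∈-tabulate⁺ P? {y} py = lookup⇒[]= y _ (trans (lookup∘tabulate _ y) (dec-true (P? y) py))

x∉p-x : ∀ (p : Subset n) x → x ∉ p - x
x∉p-x (_ ∷ p) zero    ()
x∉p-x (_ ∷ p) (suc x) (there x∈p-x) = x∉p-x p x x∈p-x

x∈p⇒∣p∣≡1+∣p-x∣ : ∀ {x} → x ∈ p → ∣ p ∣ ≡ suc ∣ p - x ∣
x∈p⇒∣p∣≡1+∣p-x∣ {p = inside ∷ p}  here = cong (suc ∘ ∣_∣) (sym (p─⊥≡p p))
x∈p⇒∣p∣≡1+∣p-x∣ {p = inside ∷ p}  (there x∈p) = cong suc (x∈p⇒∣p∣≡1+∣p-x∣ x∈p)
x∈p⇒∣p∣≡1+∣p-x∣ {p = outside ∷ p} (there x∈p) = x∈p⇒∣p∣≡1+∣p-x∣ x∈p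

module _ {f : Fin n → Fin m} (f-inj : Injective _≡_ _≡_ f) where

  injective⇒∣p∣≤∣q∣ : (∀ {y} → y ∈ p → f y ∈ q) → ∣ p ∣ ≤ ∣ q ∣
  injective⇒∣p∣≤∣q∣ = go (⊂-wellFounded _)
    where
    go : ∀ {p q} → Acc _⊂_ p → (∀ {y} → y ∈ p → f y ∈ q) → ∣ p ∣ ≤ ∣ q ∣
    go {p} {q} (acc rec) p↦q with nonempty? p
    ... | no p-empty = begin
      ∣ p ∣      ≡⟨ cong ∣_∣ (Empty-unique p-empty) ⟩
      ∣ ⊥ {n} ∣  ≡⟨ ∣⊥∣≡0 n ⟩
      0          ≤⟨ z≤n ⟩
      ∣ q ∣      ∎
      where open ≤-Reasoning
    ... | yes (y , y∈p) = begin
      ∣ p ∣            ≡⟨ x∈p⇒∣p∣≡1+∣p-x∣ y∈p ⟩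
      suc ∣ p - y ∣    ≤⟨ s≤s (go (rec (x∈p⇒p-x⊂p y∈p)) p-y↦q-fy) ⟩
      suc ∣ q - f y ∣  ≤⟨ x∈p⇒∣p-x∣<∣p∣ (p↦q y∈p) ⟩
      ∣ q ∣            ∎
      where
      open ≤-Reasoning
      p-y↦q-fy : ∀ {z} → z ∈ p - y → f z ∈ q - f y
      p-y↦q-fy {z} z∈p-y = x∈p∧x≢y⇒x∈p-y (p↦q (p─q⊆p _ _ z∈p-y))
        (λ fz≡fy → x∉p-x p y (subst (_∈ p - y) (f-inj fz≡fy) z∈p-y))

module _ {n : ℕ} (G : FiniteGroup n) where
  open FiniteGroup G

  group : Group 0ℓ 0ℓ
  group = record { isGroup = isGroup }

  open GroupProperties group
    using (\\-leftDividesˡ; \\-leftDividesʳ; //-rightDividesˡ; //-rightDividesʳ; ⁻¹-involutive; ∙-cancelˡ)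

  inRightCoset⇔ : ∀ {H : Subset n} {c x} → InRightCoset G H c x ⇔ x · inv c ∈ H
  inRightCoset⇔ {H} {c} {x} = mk⇔
    (λ (h , h∈H , x≡h·c) →
      subst (_∈ H) (sym (trans (cong (_· inv c) x≡h·c) (//-rightDividesʳ c h))) h∈H)
    (λ x·c⁻¹∈H → x · inv c , x·c⁻¹∈H , sym (//-rightDividesˡ c x))

  LeftTranslate⊆ : (H C : Subset n) → Fin n → Set
  LeftTranslate⊆ H C x = ∀ {c} → c ∈ C → x · c ∈ H

  inCosetIntersection⇔ : ∀ {H C : Subset n} {x} → InverseClosed G C →
                         InCosetIntersection G H C x ⇔ LeftTranslate⊆ H C x
  inCosetIntersection⇔ {H} {C} {x} inv-closed = mk⇔
    (λ x∈⋂Hc {c} c∈C → subst (λ d → x · d ∈ H) (⁻¹-involutive c)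
                         (Equivalence.to inRightCoset⇔ (x∈⋂Hc (inv c) (inv-closed c∈C))))
    (λ xC⊆H c c∈C → Equivalence.from inRightCoset⇔ (xC⊆H (inv-closed c∈C)))

  module _ (H C : Subset n) {x : Fin n} (x∉H : x ∉ H) where

    ∈-neighbourhood⇔ : ∀ {y} → y ∈ neighbourhood G H C x ⇔ (y ∈ H × inv x · y ∈ C)
    ∈-neighbourhood⇔ {y} = mk⇔ to from
      where
      to : y ∈ neighbourhood G H C x → y ∈ H × inv x · y ∈ C
      to y∈N with ∈-tabulate⁻ (adjacent? G H C x) y∈N
      ... | _ , inj₁ x∈H , _         = contradiction x∈H x∉H
      ... | _ , inj₂ y∈H , x⁻¹·y∈C  = y∈H , x⁻¹·y∈C

      from : y ∈ H × inv x · y ∈ C → y ∈ neighbourhood G H C x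
      from (y∈H , x⁻¹·y∈C) = ∈-tabulate⁺ (adjacent? G H C x)
        ((λ x≡y → x∉H (subst (_∈ H) (sym x≡y) y∈H)) , inj₂ y∈H , x⁻¹·y∈C)

    degree≤∣C∣ : degree G H C x ≤ ∣ C ∣
    degree≤∣C∣ =
      injective⇒∣p∣≤∣q∣ (∙-cancelˡ (inv x) _ _) (proj₂ ∘ Equivalence.to ∈-neighbourhood⇔)

    degree<∣C∣ : ∀ {c} → c ∈ C → x · c ∉ H → degree G H C x < ∣ C ∣
    degree<∣C∣ {c} c∈C x·c∉H = begin-strict
      degree G H C x  ≤⟨ injective⇒∣p∣≤∣q∣ (∙-cancelˡ (inv x) _ _) N↦C-c ⟩
      ∣ C - c ∣       <⟨ x∈p⇒∣p-x∣<∣p∣ c∈C ⟩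
      ∣ C ∣           ∎
      where
      open ≤-Reasoning
      N↦C-c : ∀ {y} → y ∈ neighbourhood G H C x → inv x · y ∈ C - c
      N↦C-c {y} y∈N with Equivalence.to ∈-neighbourhood⇔ y∈N
      ... | y∈H , x⁻¹·y∈C = x∈p∧x≢y⇒x∈p-y x⁻¹·y∈C
        (λ x⁻¹·y≡c → x·c∉H
          (subst (_∈ H) (trans (sym (\\-leftDividesˡ x y)) (cong (x ·_) x⁻¹·y≡c)) y∈H))

    ∣C∣≤degree : LeftTranslate⊆ H C x → ∣ C ∣ ≤ degree G H C x
    ∣C∣≤degree xC⊆H = injective⇒∣p∣≤∣q∣ (∙-cancelˡ x _ _)
      (λ {c} c∈C → Equivalence.from ∈-neighbourhood⇔
        (xC⊆H c∈C , subst (_∈ C) (sym (\\-leftDividesʳ x c)) c∈C))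

    degree≡∣C∣⇔ : degree G H C x ≡ ∣ C ∣ ⇔ LeftTranslate⊆ H C x
    degree≡∣C∣⇔ = mk⇔
      (λ deg≡∣C∣ {c} c∈C → decidable-stable (x · c ∈? H) (<-irrefl deg≡∣C∣ ∘ degree<∣C∣ c∈C))
      (λ xC⊆H → ≤-antisym degree≤∣C∣ (∣C∣≤degree xC⊆H))

mainTheorem12 : {n : ℕ} (G : FiniteGroup n) (H C : Subset n)
    → IsSubgroup G H → IsProper G H
    → InverseClosed G C → FiniteGroup.e G ∉ C
    → (x : Fin n) → x ∉ H
    → (degree G H C x ≡ ∣ C ∣ → InCosetIntersection G H C x)
    × (InCosetIntersection G H C x → degree G H C x ≡ ∣ C ∣)
mainTheorem12 G H C _ _ inv-closed _ x x∉H =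
  Equivalence.to degree⇔coset , Equivalence.from degree⇔coset
  where
  degree⇔coset : degree G H C x ≡ ∣ C ∣ ⇔ InCosetIntersection G H C x
  degree⇔coset = ⇔.trans (degree≡∣C∣⇔ G H C x∉H) (⇔.sym (inCosetIntersection⇔ G inv-closed))
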